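{- Let $n \geq 1$ be an integer. The set $\mathcal{A}_{n-1}$ of approval ballot triangles of size $n-1$ is in bijection with the set of totally symmetric self-complementary plane partitions inside a $2n \times 2n \times 2n$ box.
   Context: An approval ballot triangle (ABT) of size $m$ is a triangular array $A(i,j)$, $1 \leq j \leq i \leq m$, with entries in $\{0,1\}$ satisfying the row compatibility condition $\sum_{k=j}^{i} A(i,k) \leq \sum_{k=j}^{i+1} A(i+1,k)$ for all $1 \leq j \leq i \leq m-1$. $\mathcal{A}_m$ denotes the set of ABTs of size $m$ (rows are indexed top-to-bottom, columns left-to-right). A plane partition inside a $2n\times 2n \times 2n$ box is a $2n \times 2n$ array $\pi(i,j)$ of integers in $\{0,\dots,2n\}$ that are weakly decreasing along rows and columns; viewed as a stack of unit cubes in $\mathbb{R}^3$, it is totally symmetric if the cube set is invariant under all permutations of the three coordinate axes, and self-complementary if it equals its complement in the box, i.e. $\pi(i,j) + \pi(2n+1-i,2n+1-j) = 2n$ for all $i,j$. Such objects are called TSSCPPs. -}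

module Defs where

open import Data.Bool using (Bool; true; false; _∧_; _∨_; not; T)
open import Data.Nat using (ℕ; zero; suc; _+_; _∸_; _*_; _≤ᵇ_; _<ᵇ_; _≡ᵇ_)
open import Data.List using (List; map; upTo)
open import Data.Nat.ListAction using (sum)
open import Data.Bool.ListAction using (all)
open import Data.Vec using (Vec; []; _∷_)
open import Data.Product using (Σ)

-- Conventions: all indices are 0-based (paper's index i corresponds to i-1 here).

at : {X : Set} {n : ℕ} → X → Vec X n → ℕ → X
at d []       _       = d
at d (x ∷ xs) zero    = x
at d (x ∷ xs) (suc k) = at d xs k

rep : {X : Set} (k : ℕ) → X → Vec X k
rep zero    _ = []
rep (suc k) x = x ∷ rep k x

entry : {X : Set} {r c : ℕ} → X → Vec (Vec X c) r → ℕ → ℕ → X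
entry {c = c} d M i j = at d (at (rep c d) M i) j

-- the list [a, a+1, ..., b] (empty if b < a)
range : ℕ → ℕ → List ℕ
range a b = map (a +_) (upTo (suc b ∸ a))

bit : Bool → ℕ
bit true  = 1
bit false = 0

_⇔ᵇ_ : Bool → Bool → Bool
x ⇔ᵇ y = (x ∧ y) ∨ (not x ∧ not y)

-- Stored as an m × m 0/1 matrix whose entries strictly above the
-- diagonal (column > row) are required to be 0, so that the data is
-- exactly the triangular array A(i,j), 0 ≤ j ≤ i < m.

Mat01 : ℕ → Set
Mat01 m = Vec (Vec Bool m) m

A[_,_,_] : {m : ℕ} → Mat01 m → ℕ → ℕ → ℕ
A[ A , i , j ] = bit (entry false A i j)

rowSum : {m : ℕ} → Mat01 m → ℕ → ℕ → ℕ → ℕ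
rowSum A i a b = sum (map (λ k → A[ A , i , k ]) (range a b))

isTriangular : (m : ℕ) → Mat01 m → Bool
isTriangular m A =
  all (λ i → all (λ j → not (i <ᵇ j) ∨ not (entry false A i j)) (upTo m)) (upTo m)

isCompatible : (m : ℕ) → Mat01 m → Bool
isCompatible m A =
  all (λ i → not (suc i <ᵇ m) ∨
        all (λ j → rowSum A i j i ≤ᵇ rowSum A (suc i) j (suc i)) (range 0 i))
      (upTo m)

isABT : (m : ℕ) → Mat01 m → Bool
isABT m A = isTriangular m A ∧ isCompatible m A

ABT : ℕ → Set
ABT m = Σ (Mat01 m) (λ A → T (isABT m A))

Arr : ℕ → Set
Arr n = Vec (Vec ℕ (2 * n)) (2 * n)

-- π(i,j) (0-based), 0 outside the array
val : (n : ℕ) → Arr n → ℕ → ℕ → ℕ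
val n π i j = entry {r = 2 * n} {c = 2 * n} 0 π i j

boundedEntries : (n : ℕ) → Arr n → Bool
boundedEntries n π =
  all (λ i → all (λ j → val n π (i) (j) ≤ᵇ 2 * n) (upTo (2 * n))) (upTo (2 * n))

isPlanePartition : (n : ℕ) → Arr n → Bool
isPlanePartition n π =
  boundedEntries n π ∧
  all (λ i → all (λ j →
      (not (suc j <ᵇ 2 * n) ∨ (val n π (i) (suc j) ≤ᵇ val n π (i) (j))) ∧
      (not (suc i <ᵇ 2 * n) ∨ (val n π (suc i) (j) ≤ᵇ val n π (i) (j))))
    (upTo (2 * n))) (upTo (2 * n))

-- the unit cube [i,i+1]×[j,j+1]×[k,k+1] (0-based, i,j,k < 2n) belongs to
-- the stack iff k < π(i,j)
cube : {n : ℕ} → Arr n → ℕ → ℕ → ℕ → Bool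
cube {n} π i j k = k <ᵇ val n π i j

isTotallySymmetric : (n : ℕ) → Arr n → Bool
isTotallySymmetric n π =
  all (λ i → all (λ j → all (λ k →
      (c i j k ⇔ᵇ c i k j) ∧ (c i j k ⇔ᵇ c j i k) ∧ (c i j k ⇔ᵇ c j k i) ∧
      (c i j k ⇔ᵇ c k i j) ∧ (c i j k ⇔ᵇ c k j i))
    (upTo (2 * n))) (upTo (2 * n))) (upTo (2 * n))
  where c = cube {n} π

-- π(i,j) + π(2n+1-i,2n+1-j) = 2n  (1-based), i.e. with 0-based indices
-- π(i,j) + π(2n-1-i,2n-1-j) = 2n
isSelfComplementary : (n : ℕ) → Arr n → Bool
isSelfComplementary n π =
  all (λ i → all (λ j →
      (val n π (i) (j) + val n π (2 * n ∸ suc i) (2 * n ∸ suc j)) ≡ᵇ 2 * n)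
    (upTo (2 * n))) (upTo (2 * n))

isTSSCPP : (n : ℕ) → Arr n → Bool
isTSSCPP n π =
  isPlanePartition n π ∧ isTotallySymmetric n π ∧ isSelfComplementary n π

TSSCPP : ℕ → Set
TSSCPP n = Σ (Arr n) (λ π → T (isTSSCPP n π))

{-# OPTIONS --safe #-}

module Submission where

-- By total symmetry a TSSCPP in the 2n-box is determined by which cubes (i, j, k) with
-- i ≤ j ≤ k (0-based) it contains, and by self-complementarity, under which (i, j, k) is in
-- the stack iff (2n-1-k, 2n-1-j, 2n-1-i) is not, it is determined by those with j ≥ n.
-- Among these, the cubes with i + k ≥ 2n - 1 are never in the stack; the others are indexed
-- by r = n-2-i, c = k-j and t = j-n with t + c ≤ r ≤ n-2, and for fixed (r, c) the stack
-- contains exactly those with t below some height S r c. The TSSCPP conditions become: S r c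
-- decreases in c in steps of 0 or 1, vanishes at c = r + 1, and S r c ≤ S (r+1) c. These are
-- precisely the suffix sums S r c = Σ_{k ≥ c} A(r, k) of the rows of an ABT of size n - 1,
-- the last condition being row compatibility.

open import Defs

import Algebra.Properties.CommutativeSemigroup as CommSemigroupProperties

open import Data.Bool using (Bool; true; false; _∧_; _∨_; not; T; if_then_else_)
open import Data.Bool.Properties using (T-≡; T-not-≡; T-∧; T-irrelevant; not-involutive)
open import Data.Bool.ListAction using (all)
open import Data.Empty using (⊥-elim)
open import Data.List using ([]; _∷_; map; upTo; applyUpTo; length)
open import Data.List.Properties using (map-id; length-map; length-applyUpTo)
open import Data.List.Relation.Unary.All.Properties using (all⁺; all⁻; applyUpTo⁺₁; applyUpTo⁻)
open import Data.Nat
open import Data.Nat.ListAction using (sum)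
open import Data.Nat.Solver using (module +-*-Solver)
open import Data.Nat.Properties
open import Data.Product using (Σ; _×_; _,_; proj₁; proj₂)
open import Data.Sum using (inj₁; inj₂)
open import Data.Unit using (tt)
open import Data.Vec using (Vec; []; _∷_)
open import Function using (_∘_; id)
open import Function.Bundles using (_⇔_; mk⇔; Equivalence; _⤖_; mk↔ₛ′)
open import Function.Properties.Inverse using (↔⇒⤖)
open import Relation.Binary.PropositionalEquality
open import Relation.Nullary using (¬_; yes; no)

open Equivalence using (to; from)
open +-*-Solver using (solve; _:+_; _:=_)

T-extensional : ∀ {a b} → (T a → T b) → (T b → T a) → a ≡ b
T-extensional {false} {false} _ _ = refl
T-extensional {false} {true}  _ g = ⊥-elim (g tt)
T-extensional {true}  {false} f _ = ⊥-elim (f tt)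
T-extensional {true}  {true}  _ _ = refl

T-not-∨ : ∀ {a b} → T (not a ∨ b) ⇔ (T a → T b)
T-not-∨ {false} = mk⇔ (λ _ ()) (λ _ → tt)
T-not-∨ {true}  = mk⇔ (λ b _ → b) (λ f → f tt)

T-not : ∀ {a} → T (not a) ⇔ (¬ T a)
T-not {false} = mk⇔ (λ _ ()) (λ _ → tt)
T-not {true}  = mk⇔ (λ ()) (λ f → f tt)

T-⇔ᵇ : ∀ {a b} → T (a ⇔ᵇ b) ⇔ (a ≡ b)
T-⇔ᵇ {false} {false} = mk⇔ (λ _ → refl) (λ _ → tt)
T-⇔ᵇ {false} {true}  = mk⇔ (λ ()) (λ ())
T-⇔ᵇ {true}  {false} = mk⇔ (λ ()) (λ ())
T-⇔ᵇ {true}  {true}  = mk⇔ (λ _ → refl) (λ _ → tt)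

T-allUpTo : ∀ {p : ℕ → Bool} {L} → T (all p (upTo L)) ⇔ (∀ {i} → i < L → T (p i))
T-allUpTo {p} {L} = mk⇔ elim intro
  where
  elim : T (all p (upTo L)) → ∀ {i} → i < L → T (p i)
  elim h = applyUpTo⁻ id L (all⁺ p _ h)
  intro : (∀ {i} → i < L → T (p i)) → T (all p (upTo L))
  intro h = all⁻ p (applyUpTo⁺₁ id L h)

T-allUpTo₂ : ∀ {p : ℕ → ℕ → Bool} {L} →
             T (all (λ i → all (p i) (upTo L)) (upTo L)) ⇔ (∀ {i j} → i < L → j < L → T (p i j))
T-allUpTo₂ {p} {L} = mk⇔ elim intro
  where
  elim : T (all (λ i → all (p i) (upTo L)) (upTo L)) → ∀ {i j} → i < L → j < L → T (p i j)
  elim h i<L = to T-allUpTo (to T-allUpTo h i<L)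
  intro : (∀ {i j} → i < L → j < L → T (p i j)) → T (all (λ i → all (p i) (upTo L)) (upTo L))
  intro h = from T-allUpTo λ i<L → from T-allUpTo (h i<L)

T-allUpTo₃ : ∀ {p : ℕ → ℕ → ℕ → Bool} {L} →
             T (all (λ i → all (λ j → all (p i j) (upTo L)) (upTo L)) (upTo L)) ⇔
             (∀ {i j k} → i < L → j < L → k < L → T (p i j k))
T-allUpTo₃ {p} {L} = mk⇔ elim intro
  where
  elim : T (all (λ i → all (λ j → all (p i j) (upTo L)) (upTo L)) (upTo L)) →
         ∀ {i j k} → i < L → j < L → k < L → T (p i j k)
  elim h i<L j<L = to T-allUpTo (to T-allUpTo₂ h i<L j<L)
  intro : (∀ {i j k} → i < L → j < L → k < L → T (p i j k)) →
          T (all (λ i → all (λ j → all (p i j) (upTo L)) (upTo L)) (upTo L))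
  intro h = from T-allUpTo₂ λ i<L j<L → from T-allUpTo (h i<L j<L)

<ᵇ-true : ∀ {a b} → a < b → (a <ᵇ b) ≡ true
<ᵇ-true a<b = T-extensional _ (λ _ → <⇒<ᵇ a<b)

<ᵇ-false : ∀ {a b} → b ≤ a → (a <ᵇ b) ≡ false
<ᵇ-false {a} {b} b≤a = T-extensional (λ h → <⇒≱ (<ᵇ⇒< a b h) b≤a) λ ()

≤ᵇ-true : ∀ {a b} → a ≤ b → (a ≤ᵇ b) ≡ true
≤ᵇ-true a≤b = T-extensional _ (λ _ → ≤⇒≤ᵇ a≤b)

≤ᵇ-false : ∀ {a b} → b < a → (a ≤ᵇ b) ≡ false
≤ᵇ-false {a} {b} b<a = T-extensional (λ h → <⇒≱ b<a (≤ᵇ⇒≤ a b h)) λ ()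

bit-<ᵇ : ∀ {a b} → b ≤ a → a ≤ suc b → bit (b <ᵇ a) + b ≡ a
bit-<ᵇ {a} {b} b≤a a≤1+b with m≤n⇒m<n∨m≡n b≤a
... | inj₁ b<a  rewrite <ᵇ-true b<a = ≤-antisym b<a a≤1+b
... | inj₂ refl rewrite <ᵇ-false (≤-refl {b}) = refl

<ᵇ-bit+ : ∀ e b → (b <ᵇ bit e + b) ≡ e
<ᵇ-bit+ false b = <ᵇ-false (≤-refl {b})
<ᵇ-bit+ true  b = <ᵇ-true (n<1+n b)

Σ-T-≡ : ∀ {A : Set} {P : A → Bool} {a b : A} {p : T (P a)} {q : T (P b)} →
        a ≡ b → _≡_ {A = Σ A (T ∘ P)} (a , p) (b , q)
Σ-T-≡ refl = cong (_ ,_) (T-irrelevant _ _)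

≤-from-< : ∀ {a b} → (∀ {t} → t < a → t < b) → a ≤ b
≤-from-< h = ≮⇒≥ λ b<a → <-irrefl refl (h b<a)

∸-≡ : ∀ {a b c} → c + b ≡ a → a ∸ b ≡ c
∸-≡ {b = b} {c} refl = m+n∸n≡m c b

∸-split : ∀ {a b c} → a ≤ b → b ≤ c → c ∸ a ≡ (c ∸ b) + (b ∸ a)
∸-split {a} {b} {c} a≤b b≤c = ∸-≡ (begin
  c ∸ b + (b ∸ a) + a ≡⟨ +-assoc (c ∸ b) (b ∸ a) a ⟩
  c ∸ b + (b ∸ a + a) ≡⟨ cong (c ∸ b +_) (m∸n+n≡m a≤b) ⟩
  c ∸ b + b           ≡⟨ m∸n+n≡m b≤c ⟩
  c                   ∎)
  where open ≡-Reasoning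

suc∸≤ : ∀ a b → suc a ∸ b ≤ suc (a ∸ b)
suc∸≤ a       zero    = ≤-refl
suc∸≤ zero    (suc b) = ≤-trans (≤-reflexive (0∸n≡0 b)) z≤n
suc∸≤ (suc a) (suc b) = suc∸≤ a b

<∸⇒+< : ∀ {t a b} → t < a ∸ b → t + b < a
<∸⇒+< {t} {a} {b} t<a∸b with b ≤? a
... | yes b≤a = subst (t + b <_) (m∸n+n≡m b≤a) (+-monoˡ-< b t<a∸b)
... | no  b≰a with () ← subst (t <_) (m≤n⇒m∸n≡0 (<⇒≤ (≰⇒> b≰a))) t<a∸b

antitone-≤ : ∀ {f : ℕ → ℕ} → (∀ x → f (suc x) ≤ f x) → ∀ {x y} → x ≤ y → f y ≤ f x
antitone-≤ f↓ {y = zero}  z≤n = ≤-refl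
antitone-≤ f↓ {y = suc y} x≤1+y with m≤n⇒m<n∨m≡n x≤1+y
... | inj₁ x<1+y = ≤-trans (f↓ y) (antitone-≤ f↓ (≤-pred x<1+y))
... | inj₂ refl  = ≤-refl

antitone₂-≤ : ∀ {P : ℕ → ℕ → ℕ} → (∀ x y → P (suc x) y ≤ P x y) → (∀ x y → P x (suc y) ≤ P x y) →
              ∀ {x y x′ y′} → x ≤ x′ → y ≤ y′ → P x′ y′ ≤ P x y
antitone₂-≤ {P} P↓ˡ P↓ʳ {x} {y} {x′} {y′} x≤x′ y≤y′ =
  ≤-trans (antitone-≤ (λ a → P↓ˡ a y′) x≤x′) (antitone-≤ (P↓ʳ x) y≤y′)

count : ℕ → (ℕ → Bool) → ℕ
count zero    p = 0
count (suc L) p = bit (p L) + count L p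

bit≤1 : ∀ b → bit b ≤ 1
bit≤1 false = z≤n
bit≤1 true  = ≤-refl

count≤ : ∀ L p → count L p ≤ L
count≤ zero    p = z≤n
count≤ (suc L) p = +-mono-≤ (bit≤1 (p L)) (count≤ L p)

count-mono : ∀ L {p q} → (∀ {v} → v < L → T (p v) → T (q v)) → count L p ≤ count L q
count-mono zero    h = z≤n
count-mono (suc L) h = +-mono-≤ (bit-mono (h ≤-refl)) (count-mono L (h ∘ m<n⇒m<1+n))
  where
  bit-mono : ∀ {a b} → (T a → T b) → bit a ≤ bit b
  bit-mono {false}           _ = z≤n
  bit-mono {true}  {false} f = ⊥-elim (f tt)
  bit-mono {true}  {true}  _ = ≤-refl

count-initialSegment : ∀ L p {s} → s ≤ L → (∀ {v} → v < L → p v ≡ (v <ᵇ s)) → count L p ≡ s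
count-initialSegment zero    p z≤n _ = refl
count-initialSegment (suc L) p {s} s≤1+L h with m≤n⇒m<n∨m≡n s≤1+L
... | inj₁ s<1+L = cong₂ _+_ (cong bit (trans (h ≤-refl) (<ᵇ-false (≤-pred s<1+L))))
                             (count-initialSegment L p (≤-pred s<1+L) (h ∘ m<n⇒m<1+n))
... | inj₂ refl  = cong₂ _+_ (cong bit (trans (h ≤-refl) (<ᵇ-true (n<1+n L))))
                             (count-initialSegment L p ≤-refl below)
  where
  below : ∀ {v} → v < L → p v ≡ (v <ᵇ L)
  below v<L = trans (h (m<n⇒m<1+n v<L)) (trans (<ᵇ-true (m<n⇒m<1+n v<L)) (sym (<ᵇ-true v<L)))

count-all : ∀ L p → (∀ {v} → v < L → T (p v)) → count L p ≡ L
count-all L p h = count-initialSegment L p ≤-refl λ v<L → trans (to T-≡ (h v<L)) (sym (<ᵇ-true v<L))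

DownClosedBelow : ℕ → (ℕ → Bool) → Set
DownClosedBelow L p = ∀ {u v} → u ≤ v → v < L → T (p v) → T (p u)

<-count⇔ : ∀ {L p} → DownClosedBelow L p → ∀ {t} → t < count L p ⇔ (t < L × T (p t))
<-count⇔ {zero}      _  = mk⇔ (λ ()) (λ ())
<-count⇔ {suc L} {p} dc {t} with p L in pL
... | true  = subst (λ c → t < suc c ⇔ (t < suc L × T (p t))) (sym (count-all L p below))
                    (mk⇔ (λ t<1+L → t<1+L , dc (≤-pred t<1+L) ≤-refl (from T-≡ pL)) proj₁)
  where
  below : ∀ {v} → v < L → T (p v)
  below v<L = dc (<⇒≤ v<L) ≤-refl (from T-≡ pL)
... | false = mk⇔ (λ t<c → let t<L , pt = to IH t<c in m<n⇒m<1+n t<L , pt)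
                  (λ (t<1+L , pt) → from IH (t<L t<1+L pt , pt))
  where
  IH : t < count L p ⇔ (t < L × T (p t))
  IH = <-count⇔ (λ u≤v v<L → dc u≤v (m<n⇒m<1+n v<L))
  t<L : t < suc L → T (p t) → t < L
  t<L t<1+L pt with m≤n⇒m<n∨m≡n (≤-pred t<1+L)
  ... | inj₁ t<L  = t<L
  ... | inj₂ refl = ⊥-elim (subst T pL pt)

map-+-suc : ∀ a (f : ℕ → ℕ) k → map (a +_) (applyUpTo (suc ∘ f) k) ≡ map (suc a +_) (applyUpTo f k)
map-+-suc a f zero    = refl
map-+-suc a f (suc k) = cong₂ _∷_ (+-suc a (f 0)) (map-+-suc a (f ∘ suc) k)

range-cons : ∀ {a b} → a ≤ b → range a b ≡ a ∷ range (suc a) b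
range-cons {a} {b} a≤b rewrite +-∸-assoc 1 a≤b = cong₂ _∷_ (+-identityʳ a) (map-+-suc a id (b ∸ a))

range-empty : ∀ {a b} → b < a → range a b ≡ []
range-empty b<a rewrite m≤n⇒m∸n≡0 b<a = refl

range0 : ∀ i → range 0 i ≡ upTo (suc i)
range0 i = map-id (upTo (suc i))

length-range : ∀ a b → length (range a b) ≡ suc b ∸ a
length-range a b = trans (length-map (a +_) (upTo (suc b ∸ a))) (length-applyUpTo id (suc b ∸ a))

sum-bits≤length : ∀ (f : ℕ → Bool) xs → sum (map (bit ∘ f) xs) ≤ length xs
sum-bits≤length f []       = z≤n
sum-bits≤length f (x ∷ xs) = +-mono-≤ (bit≤1 (f x)) (sum-bits≤length f xs)

tabulate : {X : Set} (k : ℕ) → (ℕ → X) → Vec X k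
tabulate zero    f = []
tabulate (suc k) f = f 0 ∷ tabulate k (f ∘ suc)

tabulate₂ : {X : Set} (r c : ℕ) → (ℕ → ℕ → X) → Vec (Vec X c) r
tabulate₂ r c f = tabulate r (λ i → tabulate c (f i))

module _ {X : Set} (d : X) where

  at-tabulate : ∀ {k} f {i} → i < k → at d (tabulate k f) i ≡ f i
  at-tabulate {suc k} f {zero}  _         = refl
  at-tabulate {suc k} f {suc i} (s≤s i<k) = at-tabulate (f ∘ suc) i<k

  at-outside : ∀ {k} (v : Vec X k) {i} → k ≤ i → at d v i ≡ d
  at-outside []      _         = refl
  at-outside (x ∷ v) (s≤s k≤i) = at-outside v k≤i

  at-rep : ∀ k i → at d (rep k d) i ≡ d
  at-rep zero    i       = refl
  at-rep (suc k) zero    = refl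
  at-rep (suc k) (suc i) = at-rep k i

  at-ext : ∀ {k} (u v : Vec X k) → (∀ {i} → i < k → at d u i ≡ at d v i) → u ≡ v
  at-ext []      []      _ = refl
  at-ext (x ∷ u) (y ∷ v) h = cong₂ _∷_ (h z<s) (at-ext u v (h ∘ s≤s))

module _ {X : Set} (d : X) {r c : ℕ} where

  entry-tabulate₂ : ∀ f {i j} → i < r → j < c → entry d (tabulate₂ r c f) i j ≡ f i j
  entry-tabulate₂ f {i} i<r j<c
    rewrite at-tabulate (rep c d) (λ i → tabulate c (f i)) i<r = at-tabulate d (f i) j<c

  entry-outsideʳ : ∀ (M : Vec (Vec X c) r) i {j} → c ≤ j → entry d M i j ≡ d
  entry-outsideʳ M i = at-outside d (at (rep c d) M i)

  entry-outsideˡ : ∀ (M : Vec (Vec X c) r) {i} j → r ≤ i → entry d M i j ≡ d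
  entry-outsideˡ M j r≤i rewrite at-outside (rep c d) M r≤i = at-rep d c j

  entry-ext : ∀ (M M′ : Vec (Vec X c) r) →
              (∀ {i j} → i < r → j < c → entry d M i j ≡ entry d M′ i j) → M ≡ M′
  entry-ext M M′ h = at-ext (rep c d) M M′ λ i<r → at-ext d _ _ (h i<r)

-- Sorting triples

module ⊓-Props = CommSemigroupProperties ⊓-commutativeSemigroup
module ⊔-Props = CommSemigroupProperties ⊔-commutativeSemigroup

min₃ med₃ max₃ : ℕ → ℕ → ℕ → ℕ
min₃ x y z = x ⊓ y ⊓ z
med₃ x y z = (x ⊓ y) ⊔ (y ⊓ z) ⊔ (z ⊓ x)
max₃ x y z = x ⊔ y ⊔ z

min₃-swap : ∀ x y z → min₃ y x z ≡ min₃ x y z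
min₃-swap x y z = ⊓-Props.xy∙z≈yx∙z y x z

max₃-swap : ∀ x y z → max₃ y x z ≡ max₃ x y z
max₃-swap x y z = ⊔-Props.xy∙z≈yx∙z y x z

med₃-swap : ∀ x y z → med₃ y x z ≡ med₃ x y z
med₃-swap x y z rewrite ⊓-comm y x | ⊓-comm x z | ⊓-comm z y = ⊔-Props.xy∙z≈xz∙y (x ⊓ y) (z ⊓ x) (y ⊓ z)

min₃-rotate : ∀ x y z → min₃ y z x ≡ min₃ x y z
min₃-rotate x y z = sym (⊓-Props.xy∙z≈yz∙x x y z)

max₃-rotate : ∀ x y z → max₃ y z x ≡ max₃ x y z
max₃-rotate x y z = sym (⊔-Props.xy∙z≈yz∙x x y z)

med₃-rotate : ∀ x y z → med₃ y z x ≡ med₃ x y z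
med₃-rotate x y z = sym (⊔-Props.xy∙z≈yz∙x (x ⊓ y) (y ⊓ z) (z ⊓ x))

module _ {x y z} (x≤y : x ≤ y) (y≤z : y ≤ z) where

  min₃-sorted : min₃ x y z ≡ x
  min₃-sorted rewrite m≤n⇒m⊓n≡m x≤y = m≤n⇒m⊓n≡m (≤-trans x≤y y≤z)

  med₃-sorted : med₃ x y z ≡ y
  med₃-sorted rewrite m≤n⇒m⊓n≡m x≤y | m≤n⇒m⊓n≡m y≤z | m≥n⇒m⊓n≡n (≤-trans x≤y y≤z)
                    | m≤n⇒m⊔n≡n x≤y = m≥n⇒m⊔n≡m x≤y

  max₃-sorted : max₃ x y z ≡ z
  max₃-sorted rewrite m≤n⇒m⊔n≡n x≤y = m≤n⇒m⊔n≡n y≤z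

min₃≤med₃ : ∀ x y z → min₃ x y z ≤ med₃ x y z
min₃≤med₃ x y z = ≤-trans (m⊓n≤m (x ⊓ y) z) (≤-trans (m≤m⊔n (x ⊓ y) (y ⊓ z)) (m≤m⊔n _ (z ⊓ x)))

med₃≤max₃ : ∀ x y z → med₃ x y z ≤ max₃ x y z
med₃≤max₃ x y z = ⊔-lub (⊔-lub (≤-trans (m⊓n≤m x y) (≤-trans (m≤m⊔n x y) (m≤m⊔n _ z)))
                              (≤-trans (m⊓n≤n y z) (m≤n⊔m (x ⊔ y) z)))
                       (≤-trans (m⊓n≤n z x) (≤-trans (m≤m⊔n x y) (m≤m⊔n _ z)))

module _ {x y z x′ y′ z′} (x≤x′ : x ≤ x′) (y≤y′ : y ≤ y′) (z≤z′ : z ≤ z′) where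

  min₃-mono : min₃ x y z ≤ min₃ x′ y′ z′
  min₃-mono = ⊓-mono-≤ (⊓-mono-≤ x≤x′ y≤y′) z≤z′

  med₃-mono : med₃ x y z ≤ med₃ x′ y′ z′
  med₃-mono = ⊔-mono-≤ (⊔-mono-≤ (⊓-mono-≤ x≤x′ y≤y′) (⊓-mono-≤ y≤y′ z≤z′)) (⊓-mono-≤ z≤z′ x≤x′)

  max₃-mono : max₃ x y z ≤ max₃ x′ y′ z′
  max₃-mono = ⊔-mono-≤ (⊔-mono-≤ x≤x′ y≤y′) z≤z′

sort₃-elim : (Q : ℕ → ℕ → ℕ → Set) →
             (∀ {x y z} → Q x y z → Q y x z) →
             (∀ {x y z} → Q x y z → Q y z x) →
             (∀ {x y z} → x ≤ y → y ≤ z → Q x y z) →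
             ∀ x y z → Q x y z
sort₃-elim Q swap rotate sorted x y z with ≤-total x y | ≤-total y z | ≤-total x z
... | inj₁ x≤y | inj₁ y≤z | _        = sorted x≤y y≤z
... | inj₁ x≤y | inj₂ z≤y | inj₁ x≤z = rotate (swap (sorted x≤z z≤y))
... | inj₁ x≤y | inj₂ z≤y | inj₂ z≤x = rotate (sorted z≤x x≤y)
... | inj₂ y≤x | _        | inj₁ x≤z = swap (sorted y≤x x≤z)
... | inj₂ y≤x | inj₁ y≤z | inj₂ z≤x = rotate (rotate (sorted y≤z z≤x))
... | inj₂ y≤x | inj₂ z≤y | inj₂ z≤x = rotate (rotate (swap (sorted z≤y y≤x)))

module _ {X : Set} (f : ℕ → ℕ → ℕ → X) where

  symmetrize : ℕ → ℕ → ℕ → X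
  symmetrize x y z = f (min₃ x y z) (med₃ x y z) (max₃ x y z)

  symmetrize-swap : ∀ x y z → symmetrize y x z ≡ symmetrize x y z
  symmetrize-swap x y z rewrite min₃-swap x y z | med₃-swap x y z | max₃-swap x y z = refl

  symmetrize-rotate : ∀ x y z → symmetrize y z x ≡ symmetrize x y z
  symmetrize-rotate x y z rewrite min₃-rotate x y z | med₃-rotate x y z | max₃-rotate x y z = refl

  symmetrize-sorted : ∀ {x y z} → x ≤ y → y ≤ z → symmetrize x y z ≡ f x y z
  symmetrize-sorted x≤y y≤z
    rewrite min₃-sorted x≤y y≤z | med₃-sorted x≤y y≤z | max₃-sorted x≤y y≤z = refl

  symmetrize-reverse : ∀ x y z → symmetrize z y x ≡ symmetrize x y z
  symmetrize-reverse x y z = trans (symmetrize-swap y z x) (symmetrize-rotate x y z)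

SortedDownClosed : ℕ → (ℕ → ℕ → ℕ → Bool) → Set
SortedDownClosed N f = ∀ {i j k i′ j′ k′} → i ≤ j → j ≤ k → i′ ≤ j′ → j′ ≤ k′ →
                       i ≤ i′ → j ≤ j′ → k ≤ k′ → k′ < N → T (f i′ j′ k′) → T (f i j k)

symmetrize-downClosed : ∀ {N f} → SortedDownClosed N f →
                        ∀ {x y z x′ y′ z′} → x ≤ x′ → y ≤ y′ → z ≤ z′ → x′ < N → y′ < N → z′ < N →
                        T (symmetrize f x′ y′ z′) → T (symmetrize f x y z)
symmetrize-downClosed dc {x} {y} {z} {x′} {y′} {z′} x≤x′ y≤y′ z≤z′ x′<N y′<N z′<N =
  dc (min₃≤med₃ x y z) (med₃≤max₃ x y z) (min₃≤med₃ x′ y′ z′) (med₃≤max₃ x′ y′ z′)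
     (min₃-mono x≤x′ y≤y′ z≤z′) (med₃-mono x≤x′ y≤y′ z≤z′) (max₃-mono x≤x′ y≤y′ z≤z′)
     (⊔-lub (⊔-lub x′<N y′<N) z′<N)

-- Approval ballot triangles and their suffix sums

record IsSuffixSumTable (m : ℕ) (S : ℕ → ℕ → ℕ) : Set where
  field
    antitone   : ∀ r c → S r (suc c) ≤ S r c
    step≤1     : ∀ r c → S r c ≤ suc (S r (suc c))
    bounded    : ∀ r c → S r c ≤ suc r ∸ c
    compatible : ∀ r c → suc r < m → S r c ≤ S (suc r) c

  vanishes : ∀ r → S r (suc r) ≡ 0
  vanishes r = n≤0⇒n≡0 (≤-trans (bounded r (suc r)) (≤-reflexive (n∸n≡0 r)))

  step≤ : ∀ r c d → S r c ≤ S r (d + c) + d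
  step≤ r c zero    = m≤m+n (S r c) 0
  step≤ r c (suc d) = begin
    S r c                       ≤⟨ step≤ r c d ⟩
    S r (d + c) + d             ≤⟨ +-monoˡ-≤ d (step≤1 r (d + c)) ⟩
    suc (S r (suc d + c)) + d   ≡⟨ sym (+-suc (S r (suc d + c)) d) ⟩
    S r (suc d + c) + suc d     ∎
    where open ≤-Reasoning

  compatible-≤ : ∀ c {r r′} → r ≤ r′ → r′ < m → S r c ≤ S r′ c
  compatible-≤ c {r′ = zero}   z≤n     _    = ≤-refl
  compatible-≤ c {r′ = suc r′} r≤1+r′ 1+r′<m with m≤n⇒m<n∨m≡n r≤1+r′
  ... | inj₁ r<1+r′ = ≤-trans (compatible-≤ c (≤-pred r<1+r′) (<-trans (n<1+n r′) 1+r′<m))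
                              (compatible r′ c 1+r′<m)
  ... | inj₂ refl   = ≤-refl

  ≤-belowRight : ∀ {r r′ c c′ d} → r ≤ r′ → r′ < m → c′ ≤ c + d → S r c ≤ S r′ c′ + d
  ≤-belowRight {r} {r′} {c} {c′} {d} r≤r′ r′<m c′≤c+d = ≤-trans sameRow (+-monoˡ-≤ d (compatible-≤ c′ r≤r′ r′<m))
    where
    sameRow : S r c ≤ S r c′ + d
    sameRow with ≤-total c′ c
    ... | inj₁ c′≤c = ≤-trans (antitone-≤ (antitone r) c′≤c) (m≤m+n (S r c′) d)
    ... | inj₂ c≤c′ = begin
      S r c                       ≤⟨ step≤ r c (c′ ∸ c) ⟩
      S r (c′ ∸ c + c) + (c′ ∸ c) ≡⟨ cong (λ x → S r x + (c′ ∸ c)) (m∸n+n≡m c≤c′) ⟩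
      S r c′ + (c′ ∸ c)           ≤⟨ +-monoʳ-≤ (S r c′) (m≤n+o⇒m∸n≤o c′ c c′≤c+d) ⟩
      S r c′ + d                  ∎
      where open ≤-Reasoning

module _ {m : ℕ} where

  suffixSum : Mat01 m → ℕ → ℕ → ℕ
  suffixSum A r c = rowSum A r c r

  suffixSum-cons : ∀ (A : Mat01 m) {r c} → c ≤ r → suffixSum A r c ≡ A[ A , r , c ] + suffixSum A r (suc c)
  suffixSum-cons A c≤r = cong (sum ∘ map _) (range-cons c≤r)

  suffixSum-empty : ∀ (A : Mat01 m) {r c} → r < c → suffixSum A r c ≡ 0
  suffixSum-empty A r<c = cong (sum ∘ map _) (range-empty r<c)

  module _ {A : Mat01 m} (isA : T (isABT m A)) where

    isABT-upper : ∀ {i j} → i < j → entry false A i j ≡ false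
    isABT-upper {i} {j} i<j with i <? m | j <? m
    ... | no i≮m | _      = entry-outsideˡ false A j (≮⇒≥ i≮m)
    ... | yes _  | no j≮m = entry-outsideʳ false A i (≮⇒≥ j≮m)
    ... | yes i<m | yes j<m =
      to T-not-≡ (to T-not-∨ (to T-allUpTo (to T-allUpTo (proj₁ (to T-∧ isA)) i<m) j<m) (<⇒<ᵇ i<j))

    isABT-compatible : ∀ {i j} → suc i < m → j ≤ i → rowSum A i j i ≤ rowSum A (suc i) j (suc i)
    isABT-compatible {i} 1+i<m j≤i = ≤ᵇ⇒≤ _ _ (to T-allUpTo rowCondition (s≤s j≤i))
      where
      rowCondition : T (all (λ j → rowSum A i j i ≤ᵇ rowSum A (suc i) j (suc i)) (upTo (suc i)))
      rowCondition = subst (T ∘ all _) (range0 i)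
        (to T-not-∨ (to T-allUpTo (proj₂ (to T-∧ isA)) (<-trans (n<1+n i) 1+i<m)) (<⇒<ᵇ 1+i<m))

    suffixSum-isTable : IsSuffixSumTable m (suffixSum A)
    suffixSum-isTable = record
      { antitone   = antitone
      ; step≤1     = step≤1
      ; bounded    = λ r c → subst (suffixSum A r c ≤_) (length-range c r)
                                   (sum-bits≤length (entry false A r) (range c r))
      ; compatible = compatible
      }
      where
      antitone : ∀ r c → suffixSum A r (suc c) ≤ suffixSum A r c
      antitone r c with c ≤? r
      ... | yes c≤r = ≤-trans (m≤n+m _ _) (≤-reflexive (sym (suffixSum-cons A c≤r)))
      ... | no  c≰r = ≤-trans (≤-reflexive (suffixSum-empty A (<-trans (≰⇒> c≰r) (n<1+n c)))) z≤n
      step≤1 : ∀ r c → suffixSum A r c ≤ suc (suffixSum A r (suc c))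
      step≤1 r c with c ≤? r
      ... | yes c≤r = ≤-trans (≤-reflexive (suffixSum-cons A c≤r)) (+-monoˡ-≤ _ (bit≤1 (entry false A r c)))
      ... | no  c≰r = ≤-trans (≤-reflexive (suffixSum-empty A (≰⇒> c≰r))) z≤n
      compatible : ∀ r c → suc r < m → suffixSum A r c ≤ suffixSum A (suc r) c
      compatible r c 1+r<m with c ≤? r
      ... | yes c≤r = isABT-compatible 1+r<m c≤r
      ... | no  c≰r = ≤-trans (≤-reflexive (suffixSum-empty A (≰⇒> c≰r))) z≤n

  isABT-intro : ∀ {A : Mat01 m} →
                (∀ {i j} → i < m → j < m → i < j → entry false A i j ≡ false) →
                (∀ {i j} → suc i < m → j ≤ i → rowSum A i j i ≤ rowSum A (suc i) j (suc i)) →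
                T (isABT m A)
  isABT-intro {A} upper compatible = from T-∧ (triangular , compatibleRows)
    where
    triangular : T (isTriangular m A)
    triangular = from T-allUpTo λ i<m → from T-allUpTo λ j<m → from T-not-∨ λ i<ᵇj →
                   from T-not-≡ (upper i<m j<m (<ᵇ⇒< _ _ i<ᵇj))
    compatibleRows : T (isCompatible m A)
    compatibleRows = from (T-allUpTo {p = λ i → not (suc i <ᵇ m) ∨ all (rowOK i) (range 0 i)} {L = m}) λ {i} _ →
      from T-not-∨ λ 1+i<ᵇm → subst (T ∘ all (rowOK i)) (sym (range0 i))
        (from T-allUpTo λ j<1+i → ≤⇒≤ᵇ (compatible (<ᵇ⇒< _ _ 1+i<ᵇm) (≤-pred j<1+i)))
      where
      rowOK : ℕ → ℕ → Bool
      rowOK i j = rowSum A i j i ≤ᵇ rowSum A (suc i) j (suc i)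

  fromSuffixSums : (ℕ → ℕ → ℕ) → Mat01 m
  fromSuffixSums Q = tabulate₂ m m λ r c → (c ≤ᵇ r) ∧ (Q r (suc c) <ᵇ Q r c)

  module _ {Q : ℕ → ℕ → ℕ} (isQ : IsSuffixSumTable m Q) where

    open IsSuffixSumTable isQ

    suffixSum-fromSuffixSums : ∀ {r c} → r < m → c ≤ suc r → suffixSum (fromSuffixSums Q) r c ≡ Q r c
    suffixSum-fromSuffixSums {r} {c} r<m c≤1+r = telescope (suc r ∸ c) (m∸n+n≡m c≤1+r)
      where
      A : Mat01 m
      A = fromSuffixSums Q
      telescope : ∀ g {c} → g + c ≡ suc r → suffixSum A r c ≡ Q r c
      telescope zero    refl = trans (suffixSum-empty A (n<1+n r)) (sym (vanishes r))
      telescope (suc g) {c} g+1+c≡1+r = begin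
        suffixSum A r c                               ≡⟨ suffixSum-cons A c≤r ⟩
        A[ A , r , c ] + suffixSum A r (suc c)        ≡⟨ cong₂ _+_ entry≡ (telescope g (trans (+-suc g c) g+1+c≡1+r)) ⟩
        bit (Q r (suc c) <ᵇ Q r c) + Q r (suc c)      ≡⟨ bit-<ᵇ (antitone r c) (step≤1 r c) ⟩
        Q r c                                         ∎
        where
        open ≡-Reasoning
        c≤r : c ≤ r
        c≤r = ≤-pred (subst (c <_) g+1+c≡1+r (s≤s (m≤n+m c g)))
        entry≡ : A[ A , r , c ] ≡ bit (Q r (suc c) <ᵇ Q r c)
        entry≡ = cong bit (trans (entry-tabulate₂ false _ r<m (≤-<-trans c≤r r<m))
                                 (cong (_∧ (Q r (suc c) <ᵇ Q r c)) (≤ᵇ-true c≤r)))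

    fromSuffixSums-isABT : T (isABT m (fromSuffixSums Q))
    fromSuffixSums-isABT = isABT-intro {A = fromSuffixSums Q} upper rowCompatible
      where
      upper : ∀ {i j} → i < m → j < m → i < j → entry false (fromSuffixSums Q) i j ≡ false
      upper {i} {j} i<m j<m i<j = trans (entry-tabulate₂ false _ i<m j<m) (cong (_∧ (Q i (suc j) <ᵇ Q i j)) (≤ᵇ-false i<j))
      rowCompatible : ∀ {i j} → suc i < m → j ≤ i →
                      suffixSum (fromSuffixSums Q) i j ≤ rowSum (fromSuffixSums Q) (suc i) j (suc i)
      rowCompatible {i} {j} 1+i<m j≤i = begin
        suffixSum (fromSuffixSums Q) i j         ≡⟨ suffixSum-fromSuffixSums (<-trans (n<1+n i) 1+i<m) (m≤n⇒m≤1+n j≤i) ⟩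
        Q i j                                    ≤⟨ compatible i j 1+i<m ⟩
        Q (suc i) j                              ≡⟨ sym (suffixSum-fromSuffixSums 1+i<m (m≤n⇒m≤1+n (m≤n⇒m≤1+n j≤i))) ⟩
        suffixSum (fromSuffixSums Q) (suc i) j   ∎
        where open ≤-Reasoning

fromSuffixSums-cong : ∀ {m Q Q′} → (∀ {r c} → r < m → c ≤ suc r → Q r c ≡ Q′ r c) →
                      fromSuffixSums {m} Q ≡ fromSuffixSums Q′
fromSuffixSums-cong {m} {Q} {Q′} Q≗Q′ = entry-ext false _ _ λ {r} {c} r<m c<m →
  trans (entry-tabulate₂ false _ r<m c<m) (trans (sameEntry r<m) (sym (entry-tabulate₂ false _ r<m c<m)))
  where
  sameEntry : ∀ {r c} → r < m → ((c ≤ᵇ r) ∧ (Q r (suc c) <ᵇ Q r c)) ≡ ((c ≤ᵇ r) ∧ (Q′ r (suc c) <ᵇ Q′ r c))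
  sameEntry {r} {c} r<m with c ≤? r
  ... | yes c≤r rewrite Q≗Q′ r<m (s≤s c≤r) | Q≗Q′ r<m (m≤n⇒m≤1+n c≤r) = refl
  ... | no  c≰r rewrite ≤ᵇ-false (≰⇒> c≰r) = refl

fromSuffixSums-suffixSum : ∀ {m} {A : Mat01 m} → T (isABT m A) → fromSuffixSums (suffixSum A) ≡ A
fromSuffixSums-suffixSum {m} {A} isA = entry-ext false _ _ λ {r} {c} r<m c<m →
  trans (entry-tabulate₂ false _ r<m c<m) (sameEntry r c)
  where
  sameEntry : ∀ r c → ((c ≤ᵇ r) ∧ (suffixSum A r (suc c) <ᵇ suffixSum A r c)) ≡ entry false A r c
  sameEntry r c with c ≤? r
  ... | yes c≤r rewrite ≤ᵇ-true c≤r | suffixSum-cons A c≤r = <ᵇ-bit+ (entry false A r c) _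
  ... | no  c≰r rewrite ≤ᵇ-false (≰⇒> c≰r) = sym (isABT-upper {A = A} isA (≰⇒> c≰r))

-- Heights of TSSCPPs

module Mirror (N : ℕ) where

  mirror : ℕ → ℕ
  mirror x = N ∸ suc x

  mirror+suc : ∀ {x} → x < N → mirror x + suc x ≡ N
  mirror+suc = m∸n+n≡m

  suc+mirror : ∀ {x} → x < N → x + suc (mirror x) ≡ N
  suc+mirror {x} x<N = trans (+-suc x (mirror x)) (trans (+-comm (suc x) (mirror x)) (mirror+suc x<N))

  mirror<N : ∀ {x} → x < N → mirror x < N
  mirror<N {x} x<N = ∸-monoʳ-< z<s x<N

  mirror-involutive : ∀ {x} → x < N → mirror (mirror x) ≡ x
  mirror-involutive x<N = ∸-≡ (suc+mirror x<N)

  mirror-antitone : ∀ {x y} → x ≤ y → mirror y ≤ mirror x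
  mirror-antitone x≤y = ∸-monoʳ-≤ N (s≤s x≤y)

  mirror<∸ : ∀ {z p} → z < N → p ≤ N → (mirror z <ᵇ N ∸ p) ≡ not (z <ᵇ p)
  mirror<∸ {z} {p} z<N p≤N = T-extensional (λ h → from T-not (lt⇒ (<ᵇ⇒< _ _ h))) (λ h → <⇒<ᵇ (⇒lt (to T-not h)))
    where
    lt⇒ : mirror z < N ∸ p → ¬ T (z <ᵇ p)
    lt⇒ lt z<ᵇp = <-irrefl (mirror+suc z<N)
      (≤-<-trans (+-monoʳ-≤ (mirror z) (<ᵇ⇒< _ _ z<ᵇp)) (subst (mirror z + p <_) (m∸n+n≡m p≤N) (+-monoˡ-< p lt)))
    ⇒lt : ¬ T (z <ᵇ p) → mirror z < N ∸ p
    ⇒lt z≮p = m+n≤o⇒m≤o∸n (suc (mirror z)) (begin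
      suc (mirror z) + p ≤⟨ +-monoʳ-≤ (suc (mirror z)) (≮⇒≥ (z≮p ∘ <⇒<ᵇ)) ⟩
      suc (mirror z) + z ≡⟨ sym (+-suc (mirror z) z) ⟩
      mirror z + suc z   ≡⟨ mirror+suc z<N ⟩
      N                  ∎)
      where open ≤-Reasoning

stack : (ℕ → ℕ → ℕ) → ℕ → ℕ → ℕ → Bool
stack P x y z = z <ᵇ P x y

-- Swapping and rotating the axes generate all their permutations.
record TSSCPPHeights (N : ℕ) (P : ℕ → ℕ → ℕ) : Set where
  field
    bounded      : ∀ {x y} → x < N → y < N → P x y ≤ N
    antitoneˡ    : ∀ {x y} → suc x < N → y < N → P (suc x) y ≤ P x y
    antitoneʳ    : ∀ {x y} → x < N → suc y < N → P x (suc y) ≤ P x y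
    stack-swap   : ∀ {x y z} → x < N → y < N → z < N → stack P y x z ≡ stack P x y z
    stack-rotate : ∀ {x y z} → x < N → y < N → z < N → stack P y z x ≡ stack P x y z
    complement   : ∀ {x y} → x < N → y < N → P x y + P (N ∸ suc x) (N ∸ suc y) ≡ N

  open Mirror N

  stack-reverse : ∀ {x y z} → x < N → y < N → z < N → stack P z y x ≡ stack P x y z
  stack-reverse x<N y<N z<N = trans (stack-swap y<N z<N x<N) (stack-rotate x<N y<N z<N)

  stack-mirror : ∀ {x y z} → x < N → y < N → z < N →
                 stack P (mirror x) (mirror y) (mirror z) ≡ not (stack P x y z)
  stack-mirror {x} {y} {z} x<N y<N z<N = begin
    (mirror z <ᵇ P (mirror x) (mirror y)) ≡⟨ cong (mirror z <ᵇ_) complement′ ⟩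
    (mirror z <ᵇ N ∸ P x y)               ≡⟨ mirror<∸ z<N (bounded x<N y<N) ⟩
    not (z <ᵇ P x y)                      ∎
    where
    open ≡-Reasoning
    complement′ : P (mirror x) (mirror y) ≡ N ∸ P x y
    complement′ = sym (∸-≡ (trans (+-comm _ (P x y)) (complement x<N y<N)))

module _ {n : ℕ} where

  private
    N : ℕ
    N = 2 * n

  isTSSCPP-heights : ∀ {π} → T (isTSSCPP n π) → TSSCPPHeights N (val n π)
  isTSSCPP-heights {π} isπ = record
    { bounded      = λ x<N y<N → ≤ᵇ⇒≤ _ _ (to T-allUpTo₂ (proj₁ (to (T-∧ {boundedEntries n π}) pp)) x<N y<N)
    ; antitoneˡ    = λ 1+x<N y<N → ≤ᵇ⇒≤ _ _ (to T-not-∨ (proj₂ (monotone (<-trans (n<1+n _) 1+x<N) y<N)) (<⇒<ᵇ 1+x<N))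
    ; antitoneʳ    = λ x<N 1+y<N → ≤ᵇ⇒≤ _ _ (to T-not-∨ (proj₁ (monotone x<N (<-trans (n<1+n _) 1+y<N))) (<⇒<ᵇ 1+y<N))
    ; stack-swap   = λ x<N y<N z<N → sym (to T-⇔ᵇ (proj₁ (symmetric x<N y<N z<N)))
    ; stack-rotate = λ x<N y<N z<N → sym (to T-⇔ᵇ (proj₂ (symmetric x<N y<N z<N)))
    ; complement   = λ x<N y<N → ≡ᵇ⇒≡ _ _ (to (T-allUpTo₂ {p = λ i j → P i j + P (N ∸ suc i) (N ∸ suc j) ≡ᵇ N}) sc x<N y<N)
    }
    where
    P : ℕ → ℕ → ℕ
    P = val n π
    c : ℕ → ℕ → ℕ → Bool
    c = cube {n} π
    pp : T (isPlanePartition n π)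
    pp = proj₁ (to (T-∧ {isPlanePartition n π}) isπ)
    ts : T (isTotallySymmetric n π)
    ts = proj₁ (to (T-∧ {isTotallySymmetric n π}) (proj₂ (to (T-∧ {isPlanePartition n π}) isπ)))
    sc : T (isSelfComplementary n π)
    sc = proj₂ (to (T-∧ {isTotallySymmetric n π}) (proj₂ (to (T-∧ {isPlanePartition n π}) isπ)))
    monotone : ∀ {x y} → x < N → y < N →
               T (not (suc y <ᵇ N) ∨ (P x (suc y) ≤ᵇ P x y)) × T (not (suc x <ᵇ N) ∨ (P (suc x) y ≤ᵇ P x y))
    monotone x<N y<N = to T-∧ (to T-allUpTo₂ (proj₂ (to (T-∧ {boundedEntries n π}) pp)) x<N y<N)
    symmetric : ∀ {x y z} → x < N → y < N → z < N → T (c x y z ⇔ᵇ c y x z) × T (c x y z ⇔ᵇ c y z x)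
    symmetric {x} {y} {z} x<N y<N z<N =
      let _ , rest  = to (T-∧ {c x y z ⇔ᵇ c x z y}) (to T-allUpTo₃ ts x<N y<N z<N)
          swapped , rest′ = to (T-∧ {c x y z ⇔ᵇ c y x z}) rest
      in swapped , proj₁ (to (T-∧ {c x y z ⇔ᵇ c y z x}) rest′)

  module _ {π : Arr n} (isπ : T (isTSSCPP n π)) where

    open TSSCPPHeights (isTSSCPP-heights {π} isπ)

    val-antitoneˡ : ∀ x y → val n π (suc x) y ≤ val n π x y
    val-antitoneˡ x y with suc x <? N | y <? N
    ... | yes 1+x<N | yes y<N = antitoneˡ 1+x<N y<N
    ... | no  1+x≮N | _       = ≤-trans (≤-reflexive (entry-outsideˡ 0 π y (≮⇒≥ 1+x≮N))) z≤n
    ... | yes _     | no  y≮N = ≤-trans (≤-reflexive (entry-outsideʳ 0 π (suc x) (≮⇒≥ y≮N))) z≤n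

    val-antitoneʳ : ∀ x y → val n π x (suc y) ≤ val n π x y
    val-antitoneʳ x y with x <? N | suc y <? N
    ... | yes x<N | yes 1+y<N = antitoneʳ x<N 1+y<N
    ... | no  x≮N | _         = ≤-trans (≤-reflexive (entry-outsideˡ 0 π (suc y) (≮⇒≥ x≮N))) z≤n
    ... | yes _   | no  1+y≮N = ≤-trans (≤-reflexive (entry-outsideʳ 0 π x (≮⇒≥ 1+y≮N))) z≤n

  tabulate-isTSSCPP : ∀ {P} → TSSCPPHeights N P → T (isTSSCPP n (tabulate₂ N N P))
  tabulate-isTSSCPP {P} heights = from T-∧ (planePartition , from T-∧ (symmetric , complement′))
    where
    open TSSCPPHeights heights
    open Mirror N
    π : Arr n
    π = tabulate₂ N N P
    c : ℕ → ℕ → ℕ → Bool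
    c = cube {n} π
    val≡ : ∀ {x y} → x < N → y < N → val n π x y ≡ P x y
    val≡ = entry-tabulate₂ 0 P
    cube≡ : ∀ {x y z} → x < N → y < N → c x y z ≡ stack P x y z
    cube≡ {z = z} x<N y<N = cong (z <ᵇ_) (val≡ x<N y<N)
    cube-swap : ∀ {x y z} → x < N → y < N → z < N → c y x z ≡ c x y z
    cube-swap x<N y<N z<N = trans (cube≡ y<N x<N) (trans (stack-swap x<N y<N z<N) (sym (cube≡ x<N y<N)))
    cube-rotate : ∀ {x y z} → x < N → y < N → z < N → c y z x ≡ c x y z
    cube-rotate x<N y<N z<N = trans (cube≡ y<N z<N) (trans (stack-rotate x<N y<N z<N) (sym (cube≡ x<N y<N)))
    planePartition : T (isPlanePartition n π)
    planePartition = from T-∧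
      ( from T-allUpTo₂ (λ x<N y<N → ≤⇒≤ᵇ (subst (_≤ N) (sym (val≡ x<N y<N)) (bounded x<N y<N)))
      , from T-allUpTo₂ λ x<N y<N → from T-∧
          ( from T-not-∨ (λ 1+y<ᵇN → let 1+y<N = <ᵇ⇒< _ _ 1+y<ᵇN in
              ≤⇒≤ᵇ (subst₂ _≤_ (sym (val≡ x<N 1+y<N)) (sym (val≡ x<N y<N)) (antitoneʳ x<N 1+y<N)))
          , from T-not-∨ (λ 1+x<ᵇN → let 1+x<N = <ᵇ⇒< _ _ 1+x<ᵇN in
              ≤⇒≤ᵇ (subst₂ _≤_ (sym (val≡ 1+x<N y<N)) (sym (val≡ x<N y<N)) (antitoneˡ 1+x<N y<N)))))
    symmetric : T (isTotallySymmetric n π)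
    symmetric = from T-allUpTo₃ λ i<N j<N k<N → let
        ikj = trans (cube-swap k<N i<N j<N) (trans (cube-rotate j<N k<N i<N) (cube-rotate i<N j<N k<N))
        jik = cube-swap i<N j<N k<N
        jki = cube-rotate i<N j<N k<N
        kij = trans (cube-rotate j<N k<N i<N) (cube-rotate i<N j<N k<N)
        kji = trans (cube-swap j<N k<N i<N) (cube-rotate i<N j<N k<N)
      in from T-∧ (from T-⇔ᵇ (sym ikj) , from T-∧ (from T-⇔ᵇ (sym jik) ,
         from T-∧ (from T-⇔ᵇ (sym jki) , from T-∧ (from T-⇔ᵇ (sym kij) , from T-⇔ᵇ (sym kji)))))
    complement′ : T (isSelfComplementary n π)
    complement′ = from T-allUpTo₂ λ x<N y<N → ≡⇒≡ᵇ _ _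
      (trans (cong₂ _+_ (val≡ x<N y<N) (val≡ (mirror<N x<N) (mirror<N y<N))) (complement x<N y<N))

-- The fundamental domain

module Box (m : ℕ) where

  n N : ℕ
  n = suc m
  N = n + n

  open Mirror N public

  n≤mirror : ∀ {j} → j < n → n ≤ mirror j
  n≤mirror {j} j<n = m+n≤o⇒m≤o∸n n (begin
    n + suc j ≤⟨ +-monoʳ-≤ n j<n ⟩
    N         ∎)
    where open ≤-Reasoning

  mirror<n : ∀ {j} → n ≤ j → mirror j < n
  mirror<n {j} n≤j = m<n+o⇒m∸n<o N (suc j) (+-monoˡ-< n (s≤s n≤j))

  mirror≤ : ∀ {j k} → N ≤ suc (j + k) → mirror k ≤ j
  mirror≤ {j} {k} N≤1+j+k = m≤n+o⇒m∸n≤o N (suc k) (subst (N ≤_) (cong suc (+-comm j k)) N≤1+j+k)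

  row<m : ∀ {i} → i < m → m ∸ suc i < m
  row<m i<m = ∸-monoʳ-< z<s i<m

  row-involutive : ∀ {r} → r < m → m ∸ suc (m ∸ suc r) ≡ r
  row-involutive {r} r<m = ∸-≡ (trans (+-suc r (m ∸ suc r)) (m+[n∸m]≡n r<m))

  free⇒inBox : ∀ {r y} → r < m → y ≤ n + r → suc (m ∸ suc r + y) < N
  free⇒inBox {r} {y} r<m y≤n+r = s≤s (begin-strict
    m ∸ suc r + y       ≤⟨ +-monoʳ-≤ (m ∸ suc r) y≤n+r ⟩
    m ∸ suc r + (n + r) <⟨ +-monoʳ-< (m ∸ suc r) (+-monoʳ-< n (n<1+n r)) ⟩
    m ∸ suc r + (n + suc r) ≡⟨ cong (m ∸ suc r +_) (+-comm n (suc r)) ⟩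
    m ∸ suc r + (suc r + n) ≡⟨ sym (+-assoc (m ∸ suc r) (suc r) n) ⟩
    m ∸ suc r + suc r + n   ≡⟨ cong (_+ n) (m∸n+n≡m r<m) ⟩
    m + n                   ∎)
    where open ≤-Reasoning

  inBox⇒free : ∀ {i j k} → n ≤ j → j ≤ k → suc (i + k) < N → i < m × (j ∸ n) + (k ∸ j) < suc (m ∸ suc i)
  inBox⇒free {i} {j} {k} n≤j j≤k inBox = i<m , (begin-strict
    (j ∸ n) + (k ∸ j)  ≡⟨ +-comm (j ∸ n) (k ∸ j) ⟩
    (k ∸ j) + (j ∸ n)  ≡⟨ sym (∸-split n≤j j≤k) ⟩
    k ∸ n              <⟨ m+n≤o⇒m≤o∸n (suc (k ∸ n)) (+-cancelʳ-< n _ m (subst (_< m + n) (sym below) (≤-pred inBox))) ⟩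
    m ∸ i              ≡⟨ +-∸-assoc 1 i<m ⟩
    suc (m ∸ suc i)    ∎)
    where
    open ≤-Reasoning
    n≤k : n ≤ k
    n≤k = ≤-trans n≤j j≤k
    below : k ∸ n + i + n ≡ i + k
    below = trans (solve 3 (λ a b c → a :+ b :+ c := b :+ (a :+ c)) refl (k ∸ n) i n) (cong (i +_) (m∸n+n≡m n≤k))
    i<m : i < m
    i<m = ≤-pred (+-cancelʳ-< n (suc i) n (≤-<-trans (s≤s (+-monoʳ-≤ i n≤k)) inBox))

  ≤mirror : ∀ {i k} → i + k < N → k ≤ mirror i
  ≤mirror {i} {k} i+k<N = m+n≤o⇒m≤o∸n k (subst (_≤ N) (sym (trans (+-suc k i) (cong suc (+-comm k i)))) i+k<N)

  ≤mirror+mirror : ∀ {i k} → k < N → i + k < N → N ≤ suc (mirror k + mirror i)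
  ≤mirror+mirror {i} {k} k<N i+k<N = begin
    N                         ≡⟨ sym (mirror+suc k<N) ⟩
    mirror k + suc k          ≤⟨ +-monoʳ-≤ (mirror k) (s≤s (≤mirror i+k<N)) ⟩
    mirror k + suc (mirror i) ≡⟨ +-suc (mirror k) (mirror i) ⟩
    suc (mirror k + mirror i) ∎
    where open ≤-Reasoning

  tableOf : (ℕ → ℕ → ℕ) → ℕ → ℕ → ℕ
  tableOf P r c = count (suc r ∸ c) λ t → stack P (n + t) (n + t + c) (m ∸ suc r)

  module _ {P : ℕ → ℕ → ℕ} (P↓ˡ : ∀ x y → P (suc x) y ≤ P x y) (P↓ʳ : ∀ x y → P x (suc y) ≤ P x y) where

    <-tableOf⇔ : ∀ {r c t} → t < tableOf P r c ⇔ (t < suc r ∸ c × T (stack P (n + t) (n + t + c) (m ∸ suc r)))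
    <-tableOf⇔ {r} {c} = <-count⇔ λ {u} {v} u≤v _ h →
      <⇒<ᵇ (<-≤-trans (<ᵇ⇒< _ _ h) (antitone₂-≤ P↓ˡ P↓ʳ (+-monoʳ-≤ n u≤v) (+-monoˡ-≤ c (+-monoʳ-≤ n u≤v))))

    <ᵇ-tableOf : ∀ {r c t} → t < suc r ∸ c → (t <ᵇ tableOf P r c) ≡ stack P (n + t) (n + t + c) (m ∸ suc r)
    <ᵇ-tableOf {r} {c} t<L = T-extensional (proj₂ ∘ to (<-tableOf⇔ {r} {c}) ∘ <ᵇ⇒< _ _) (λ h → <⇒<ᵇ (from <-tableOf⇔ (t<L , h)))

    tableOf-isTable : IsSuffixSumTable m (tableOf P)
    tableOf-isTable = record
      { antitone   = λ r c → ≤-from-< (antitone r c)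
      ; step≤1     = λ r c → ≤-from-< (step≤1 r c)
      ; bounded    = λ r c → count≤ (suc r ∸ c) _
      ; compatible = λ r c _ → ≤-from-< (compatible r c)
      }
      where
      antitone : ∀ r c {t} → t < tableOf P r (suc c) → t < tableOf P r c
      antitone r c t<T = let t<L , h = to (<-tableOf⇔ {r} {suc c}) t<T in
        from (<-tableOf⇔ {r} {c}) (<-≤-trans t<L (∸-monoʳ-≤ (suc r) (n≤1+n c)) ,
                         <⇒<ᵇ (<-≤-trans (<ᵇ⇒< _ _ h) (antitone₂-≤ P↓ˡ P↓ʳ ≤-refl (+-monoʳ-≤ (n + _) (n≤1+n c)))))
      step≤1 : ∀ r c {t} → t < tableOf P r c → t < suc (tableOf P r (suc c))
      step≤1 r c {zero}  _      = z<s
      step≤1 r c {suc t} 1+t<T = let 1+t<L , h = to (<-tableOf⇔ {r} {c}) 1+t<T in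
        s≤s (from (<-tableOf⇔ {r} {suc c}) (≤-pred (≤-trans 1+t<L (suc∸≤ r c)) ,
                              <⇒<ᵇ (<-≤-trans (<ᵇ⇒< _ _ h) (antitone₂-≤ P↓ˡ P↓ʳ (+-monoʳ-≤ n (n≤1+n t)) (≤-reflexive shift)))))
        where
        shift : n + t + suc c ≡ n + suc t + c
        shift = trans (+-suc (n + t) c) (cong (_+ c) (sym (+-suc n t)))
      compatible : ∀ r c {t} → t < tableOf P r c → t < tableOf P (suc r) c
      compatible r c {t} t<T = let t<L , h = to (<-tableOf⇔ {r} {c}) t<T in
        from (<-tableOf⇔ {suc r} {c}) (<-≤-trans t<L (∸-monoˡ-≤ c (n≤1+n (suc r))) ,
                         <⇒<ᵇ (≤-<-trans (∸-monoʳ-≤ m (n≤1+n (suc r))) (<ᵇ⇒< (m ∸ suc r) (P (n + t) (n + t + c)) h)))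

  module Cubes (S : ℕ → ℕ → ℕ) where

    upperCube : ℕ → ℕ → ℕ → Bool
    upperCube i j k = (suc (i + k) <ᵇ N) ∧ (j ∸ n <ᵇ S (m ∸ suc i) (k ∸ j))

    sortedCube : ℕ → ℕ → ℕ → Bool
    sortedCube i j k = if j <ᵇ n then not (upperCube (mirror k) (mirror j) (mirror i)) else upperCube i j k

    cubeOf : ℕ → ℕ → ℕ → Bool
    cubeOf = symmetrize sortedCube

    heightsOf : ℕ → ℕ → ℕ
    heightsOf x y = count N (cubeOf x y)

    upperCube-outside : ∀ {i k} j → N ≤ suc (i + k) → upperCube i j k ≡ false
    upperCube-outside _ N≤ rewrite <ᵇ-false N≤ = refl

    sortedCube-lower : ∀ {i j k} → j < n → sortedCube i j k ≡ not (upperCube (mirror k) (mirror j) (mirror i))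
    sortedCube-lower j<n rewrite <ᵇ-true j<n = refl

    sortedCube-upper : ∀ {i j k} → n ≤ j → sortedCube i j k ≡ upperCube i j k
    sortedCube-upper n≤j rewrite <ᵇ-false n≤j = refl

    sortedCube-mirror : ∀ {i j k} → i ≤ j → j ≤ k → k < N →
                        sortedCube (mirror k) (mirror j) (mirror i) ≡ not (sortedCube i j k)
    sortedCube-mirror {i} {j} {k} i≤j j≤k k<N with j <? n
    ... | yes j<n = begin
      sortedCube (mirror k) (mirror j) (mirror i)      ≡⟨ sortedCube-upper (n≤mirror j<n) ⟩
      upperCube (mirror k) (mirror j) (mirror i)       ≡⟨ sym (not-involutive _) ⟩
      not (not (upperCube (mirror k) (mirror j) (mirror i))) ≡⟨ cong not (sym (sortedCube-lower j<n)) ⟩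
      not (sortedCube i j k)                           ∎
      where open ≡-Reasoning
    ... | no j≮n = begin
      sortedCube (mirror k) (mirror j) (mirror i)      ≡⟨ sortedCube-lower (mirror<n (≮⇒≥ j≮n)) ⟩
      not (upperCube (mirror (mirror i)) (mirror (mirror j)) (mirror (mirror k)))
        ≡⟨ cong not (cong₃ upperCube (mirror-involutive i<N) (mirror-involutive j<N) (mirror-involutive k<N)) ⟩
      not (upperCube i j k)                            ≡⟨ cong not (sym (sortedCube-upper (≮⇒≥ j≮n))) ⟩
      not (sortedCube i j k)                           ∎
      where
      open ≡-Reasoning
      j<N : j < N
      j<N = ≤-<-trans j≤k k<N
      i<N : i < N
      i<N = ≤-<-trans i≤j j<N
      cong₃ : ∀ (f : ℕ → ℕ → ℕ → Bool) {a a′ b b′ c c′} → a ≡ a′ → b ≡ b′ → c ≡ c′ → f a b c ≡ f a′ b′ c′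
      cong₃ f refl refl refl = refl

    cubeOf-mirror : ∀ {x y z} → x < N → y < N → z < N → cubeOf (mirror x) (mirror y) (mirror z) ≡ not (cubeOf x y z)
    cubeOf-mirror {x} {y} {z} = sort₃-elim Mirrored swap rotate sorted x y z
      where
      Mirrored : ℕ → ℕ → ℕ → Set
      Mirrored x y z = x < N → y < N → z < N → cubeOf (mirror x) (mirror y) (mirror z) ≡ not (cubeOf x y z)
      swap : ∀ {x y z} → Mirrored x y z → Mirrored y x z
      swap {x} {y} {z} h y<N x<N z<N = trans (symmetrize-swap sortedCube (mirror x) (mirror y) (mirror z))
        (trans (h x<N y<N z<N) (cong not (sym (symmetrize-swap sortedCube x y z))))
      rotate : ∀ {x y z} → Mirrored x y z → Mirrored y z x
      rotate {x} {y} {z} h y<N z<N x<N = trans (symmetrize-rotate sortedCube (mirror x) (mirror y) (mirror z))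
        (trans (h x<N y<N z<N) (cong not (sym (symmetrize-rotate sortedCube x y z))))
      sorted : ∀ {x y z} → x ≤ y → y ≤ z → Mirrored x y z
      sorted {x} {y} {z} x≤y y≤z _ _ z<N = begin
        cubeOf (mirror x) (mirror y) (mirror z)     ≡⟨ symmetrize-reverse sortedCube (mirror z) (mirror y) (mirror x) ⟩
        cubeOf (mirror z) (mirror y) (mirror x)     ≡⟨ symmetrize-sorted sortedCube (mirror-antitone y≤z) (mirror-antitone x≤y) ⟩
        sortedCube (mirror z) (mirror y) (mirror x) ≡⟨ sortedCube-mirror x≤y y≤z z<N ⟩
        not (sortedCube x y z)                      ≡⟨ cong not (sym (symmetrize-sorted sortedCube x≤y y≤z)) ⟩
        not (cubeOf x y z)                          ∎
        where open ≡-Reasoning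

    module _ (isS : IsSuffixSumTable m S) where

      open IsSuffixSumTable isS

      upperCube-downClosed : ∀ {i j k i′ j′ k′} → n ≤ j → j ≤ k → j′ ≤ k′ → i ≤ i′ → j ≤ j′ → k ≤ k′ →
                             T (upperCube i′ j′ k′) → T (upperCube i j k)
      upperCube-downClosed {i} {j} {k} {i′} {j′} {k′} n≤j j≤k j′≤k′ i≤i′ j≤j′ k≤k′ cube′ =
        from T-∧ (<⇒<ᵇ inBox , <⇒<ᵇ belowHeight)
        where
        inBox′ : suc (i′ + k′) < N
        inBox′ = <ᵇ⇒< _ _ (proj₁ (to T-∧ cube′))
        belowHeight′ : j′ ∸ n < S (m ∸ suc i′) (k′ ∸ j′)
        belowHeight′ = <ᵇ⇒< _ _ (proj₂ (to (T-∧ {suc (i′ + k′) <ᵇ N}) cube′))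
        inBox : suc (i + k) < N
        inBox = ≤-<-trans (s≤s (+-mono-≤ i≤i′ k≤k′)) inBox′
        i<m : i < m
        i<m = proj₁ (inBox⇒free n≤j j≤k inBox)
        shifted : S (m ∸ suc i′) (k′ ∸ j′) ≤ S (m ∸ suc i) (k ∸ j) + (j′ ∸ j)
        shifted = ≤-belowRight (∸-monoʳ-≤ m (s≤s i≤i′)) (row<m i<m)
                    (≤-trans (∸-monoˡ-≤ j k≤k′) (≤-reflexive (∸-split j≤j′ j′≤k′)))
        belowHeight : j ∸ n < S (m ∸ suc i) (k ∸ j)
        belowHeight = +-cancelʳ-< (j′ ∸ j) (j ∸ n) _ (begin-strict
          j ∸ n + (j′ ∸ j)                ≡⟨ +-comm (j ∸ n) (j′ ∸ j) ⟩
          j′ ∸ j + (j ∸ n)                ≡⟨ sym (∸-split n≤j j≤j′) ⟩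
          j′ ∸ n                          <⟨ belowHeight′ ⟩
          S (m ∸ suc i′) (k′ ∸ j′)        ≤⟨ shifted ⟩
          S (m ∸ suc i) (k ∸ j) + (j′ ∸ j) ∎)
          where open ≤-Reasoning

      sortedCube-downClosed : SortedDownClosed N sortedCube
      sortedCube-downClosed {i} {j} {k} {i′} {j′} {k′} i≤j j≤k i′≤j′ j′≤k′ i≤i′ j≤j′ k≤k′ k′<N cube′
        with j <? n | j′ <? n
      ... | no j≮n | _ = subst T (sym (sortedCube-upper (≮⇒≥ j≮n)))
        (upperCube-downClosed (≮⇒≥ j≮n) j≤k j′≤k′ i≤i′ j≤j′ k≤k′
          (subst T (sortedCube-upper (≤-trans (≮⇒≥ j≮n) j≤j′)) cube′))
      ... | yes j<n | no j′≮n = subst T (sym (trans (sortedCube-lower j<n) (cong not (upperCube-outside (mirror j) lowerHalf)))) tt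
        where
        inBox′ : suc (i′ + k′) < N
        inBox′ = <ᵇ⇒< _ _ (proj₁ (to T-∧ (subst T (sortedCube-upper (≮⇒≥ j′≮n)) cube′)))
        lowerHalf : N ≤ suc (mirror k + mirror i)
        lowerHalf = ≤mirror+mirror (≤-<-trans k≤k′ k′<N) (<-trans (n<1+n _) (≤-<-trans (s≤s (+-mono-≤ i≤i′ k≤k′)) inBox′))
      ... | yes j<n | yes j′<n = subst T (sym (sortedCube-lower j<n)) (from T-not λ mirrored →
        to T-not (subst T (sortedCube-lower j′<n) cube′)
          (upperCube-downClosed (n≤mirror j′<n) (mirror-antitone i′≤j′) (mirror-antitone i≤j)
             (mirror-antitone k≤k′) (mirror-antitone j≤j′) (mirror-antitone i≤i′) mirrored))

      cubeOf-downClosed : ∀ {x y z x′ y′ z′} → x ≤ x′ → y ≤ y′ → z ≤ z′ → x′ < N → y′ < N → z′ < N →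
                          T (cubeOf x′ y′ z′) → T (cubeOf x y z)
      cubeOf-downClosed = symmetrize-downClosed sortedCube-downClosed

      heightsOf-stack : ∀ {x y z} → x < N → y < N → z < N → stack heightsOf x y z ≡ cubeOf x y z
      heightsOf-stack {x} {y} x<N y<N z<N =
        T-extensional (λ h → proj₂ (to (<-count⇔ column) (<ᵇ⇒< _ _ h))) (λ h → <⇒<ᵇ (from (<-count⇔ column) (z<N , h)))
        where
        column : DownClosedBelow N (cubeOf x y)
        column u≤v v<N = cubeOf-downClosed ≤-refl ≤-refl u≤v x<N y<N v<N

      heightsOf-complement : ∀ {x y} → x < N → y < N → heightsOf x y + heightsOf (mirror x) (mirror y) ≡ N
      heightsOf-complement {x} {y} x<N y<N = begin
        heightsOf x y + heightsOf (mirror x) (mirror y) ≡⟨ cong (heightsOf x y +_) mirrored ⟩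
        heightsOf x y + (N ∸ heightsOf x y)             ≡⟨ m+[n∸m]≡n (count≤ N (cubeOf x y)) ⟩
        N                                               ∎
        where
        open ≡-Reasoning
        mirrored : heightsOf (mirror x) (mirror y) ≡ N ∸ heightsOf x y
        mirrored = count-initialSegment N (cubeOf (mirror x) (mirror y)) (m∸n≤m N (heightsOf x y)) λ {z} z<N → begin
          cubeOf (mirror x) (mirror y) z                  ≡⟨ cong (cubeOf (mirror x) (mirror y)) (sym (mirror-involutive z<N)) ⟩
          cubeOf (mirror x) (mirror y) (mirror (mirror z)) ≡⟨ cubeOf-mirror x<N y<N (mirror<N z<N) ⟩
          not (cubeOf x y (mirror z))                     ≡⟨ cong not (sym (heightsOf-stack x<N y<N (mirror<N z<N))) ⟩
          not (mirror z <ᵇ heightsOf x y)                 ≡⟨ sym (mirror<∸ (mirror<N z<N) (count≤ N (cubeOf x y))) ⟩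
          (mirror (mirror z) <ᵇ N ∸ heightsOf x y)        ≡⟨ cong (_<ᵇ N ∸ heightsOf x y) (mirror-involutive z<N) ⟩
          (z <ᵇ N ∸ heightsOf x y)                        ∎

      heightsOf-TSSCPP : TSSCPPHeights N heightsOf
      heightsOf-TSSCPP = record
        { bounded      = λ _ _ → count≤ N _
        ; antitoneˡ    = λ 1+x<N y<N → count-mono N λ v<N → cubeOf-downClosed (n≤1+n _) ≤-refl ≤-refl 1+x<N y<N v<N
        ; antitoneʳ    = λ x<N 1+y<N → count-mono N λ v<N → cubeOf-downClosed ≤-refl (n≤1+n _) ≤-refl x<N 1+y<N v<N
        ; stack-swap   = λ {x} {y} {z} x<N y<N z<N → trans (heightsOf-stack y<N x<N z<N)
                           (trans (symmetrize-swap sortedCube x y z) (sym (heightsOf-stack x<N y<N z<N)))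
        ; stack-rotate = λ {x} {y} {z} x<N y<N z<N → trans (heightsOf-stack y<N z<N x<N)
                           (trans (symmetrize-rotate sortedCube x y z) (sym (heightsOf-stack x<N y<N z<N)))
        ; complement   = heightsOf-complement
        }

      tableOf-heightsOf : ∀ {P} → (∀ {x y} → x < N → y < N → P x y ≡ heightsOf x y) →
                          ∀ {r c} → r < m → tableOf P r c ≡ S r c
      tableOf-heightsOf {P} P≡ {r} {c} r<m = count-initialSegment (suc r ∸ c) _ (bounded r c) column
        where
        column : ∀ {t} → t < suc r ∸ c → stack P (n + t) (n + t + c) (m ∸ suc r) ≡ (t <ᵇ S r c)
        column {t} t<L = begin
          stack P (n + t) (n + t + c) (m ∸ suc r)           ≡⟨ cong (m ∸ suc r <ᵇ_) (P≡ x<N y<N) ⟩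
          stack heightsOf (n + t) (n + t + c) (m ∸ suc r)   ≡⟨ heightsOf-stack x<N y<N (≤-<-trans i≤x x<N) ⟩
          cubeOf (n + t) (n + t + c) (m ∸ suc r)            ≡⟨ symmetrize-rotate sortedCube (m ∸ suc r) (n + t) (n + t + c) ⟩
          cubeOf (m ∸ suc r) (n + t) (n + t + c)            ≡⟨ symmetrize-sorted sortedCube i≤x x≤y ⟩
          sortedCube (m ∸ suc r) (n + t) (n + t + c)        ≡⟨ sortedCube-upper (m≤m+n n t) ⟩
          upperCube (m ∸ suc r) (n + t) (n + t + c)         ≡⟨ cong (_∧ (n + t ∸ n <ᵇ S (m ∸ suc (m ∸ suc r)) (n + t + c ∸ (n + t))))
                                                                   (<ᵇ-true (free⇒inBox r<m y≤n+r)) ⟩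
          (n + t ∸ n <ᵇ S (m ∸ suc (m ∸ suc r)) (n + t + c ∸ (n + t)))
            ≡⟨ cong₂ (λ a b → a <ᵇ S b (n + t + c ∸ (n + t))) (m+n∸m≡n n t) (row-involutive r<m) ⟩
          (t <ᵇ S r (n + t + c ∸ (n + t)))                  ≡⟨ cong (λ a → t <ᵇ S r a) (m+n∸m≡n (n + t) c) ⟩
          (t <ᵇ S r c)                                      ∎
          where
          open ≡-Reasoning
          y≤n+r : n + t + c ≤ n + r
          y≤n+r = subst (_≤ n + r) (sym (+-assoc n t c)) (+-monoʳ-≤ n (≤-pred (<∸⇒+< t<L)))
          x≤y : n + t ≤ n + t + c
          x≤y = m≤m+n (n + t) c
          y<N : n + t + c < N
          y<N = ≤-<-trans y≤n+r (+-monoʳ-< n (m<n⇒m<1+n r<m))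
          x<N : n + t < N
          x<N = ≤-<-trans x≤y y<N
          i≤x : m ∸ suc r ≤ n + t
          i≤x = ≤-trans (m∸n≤m m (suc r)) (≤-trans (n≤1+n m) (m≤m+n n t))

  module _ {P : ℕ → ℕ → ℕ} (heights : TSSCPPHeights N P)
           (P↓ˡ : ∀ x y → P (suc x) y ≤ P x y) (P↓ʳ : ∀ x y → P x (suc y) ≤ P x y) where

    open TSSCPPHeights heights

    -- The mirror image of such a cube lies below it, and exactly one of the two is in the stack.
    stack-forcedOut : ∀ {i j k} → n ≤ j → i ≤ j → j ≤ k → k < N → N ≤ suc (i + k) → stack P i j k ≡ false
    stack-forcedOut {i} {j} {k} n≤j i≤j j≤k k<N N≤ = to T-not-≡ (from T-not λ inside →
      to T-not (subst T (trans (stack-mirror k<N j<N i<N) (cong not (stack-reverse i<N j<N k<N))) (mirrorInside inside))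
               inside)
      where
      j<N : j < N
      j<N = ≤-<-trans j≤k k<N
      i<N : i < N
      i<N = ≤-<-trans i≤j j<N
      mirrorInside : T (stack P i j k) → T (stack P (mirror k) (mirror j) (mirror i))
      mirrorInside h = <⇒<ᵇ (≤-<-trans (mirror≤ (subst (N ≤_) (cong suc (+-comm i k)) N≤))
                         (<-≤-trans (<ᵇ⇒< _ _ h) (antitone₂-≤ P↓ˡ P↓ʳ (mirror≤ N≤) (mirror≤ (≤-trans (+-mono-≤ n≤j n≤j) (n≤1+n _))))))

    module _ {S : ℕ → ℕ → ℕ} (S≡ : ∀ {r c} → r < m → c ≤ suc r → S r c ≡ tableOf P r c) where

      open Cubes S

      upperCube-stack : ∀ {i j k} → n ≤ j → i ≤ j → j ≤ k → k < N → upperCube i j k ≡ stack P i j k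
      upperCube-stack {i} {j} {k} n≤j i≤j j≤k k<N with suc (i + k) <? N
      ... | no  outside = trans (upperCube-outside j (≮⇒≥ outside)) (sym (stack-forcedOut n≤j i≤j j≤k k<N (≮⇒≥ outside)))
      ... | yes inBox   = begin
        upperCube i j k                    ≡⟨ cong (_∧ (j ∸ n <ᵇ S (m ∸ suc i) (k ∸ j))) (<ᵇ-true inBox) ⟩
        (j ∸ n <ᵇ S (m ∸ suc i) (k ∸ j))   ≡⟨ cong (j ∸ n <ᵇ_) (S≡ (row<m i<m) (≤-trans (m≤n+m _ _) (<⇒≤ t+c<1+r))) ⟩
        (j ∸ n <ᵇ tableOf P r c)           ≡⟨ <ᵇ-tableOf P↓ˡ P↓ʳ t<1+r∸c ⟩
        stack P (n + (j ∸ n)) (n + (j ∸ n) + c) (m ∸ suc r) ≡⟨ cong₂ (λ a b → stack P a (a + c) b) (m+[n∸m]≡n n≤j) (row-involutive i<m) ⟩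
        stack P j (j + (k ∸ j)) i          ≡⟨ cong (λ b → stack P j b i) (m+[n∸m]≡n j≤k) ⟩
        stack P j k i                      ≡⟨ stack-rotate i<N j<N k<N ⟩
        stack P i j k                      ∎
        where
        open ≡-Reasoning
        r c : ℕ
        r = m ∸ suc i
        c = k ∸ j
        j<N : j < N
        j<N = ≤-<-trans j≤k k<N
        i<N : i < N
        i<N = ≤-<-trans i≤j j<N
        i<m : i < m
        i<m = proj₁ (inBox⇒free n≤j j≤k inBox)
        t+c<1+r : (j ∸ n) + c < suc r
        t+c<1+r = proj₂ (inBox⇒free n≤j j≤k inBox)
        t<1+r∸c : j ∸ n < suc r ∸ c
        t<1+r∸c = m+n≤o⇒m≤o∸n (suc (j ∸ n)) t+c<1+r

      sortedCube-stack : ∀ {i j k} → i ≤ j → j ≤ k → k < N → sortedCube i j k ≡ stack P i j k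
      sortedCube-stack {i} {j} {k} i≤j j≤k k<N with j <? n
      ... | no  j≮n = trans (sortedCube-upper (≮⇒≥ j≮n)) (upperCube-stack (≮⇒≥ j≮n) i≤j j≤k k<N)
      ... | yes j<n = begin
        sortedCube i j k                                   ≡⟨ sortedCube-lower j<n ⟩
        not (upperCube (mirror k) (mirror j) (mirror i))   ≡⟨ cong not (upperCube-stack (n≤mirror j<n) (mirror-antitone j≤k)
                                                                          (mirror-antitone i≤j) (mirror<N i<N)) ⟩
        not (stack P (mirror k) (mirror j) (mirror i))     ≡⟨ cong not (stack-mirror k<N j<N i<N) ⟩
        not (not (stack P k j i))                          ≡⟨ not-involutive _ ⟩
        stack P k j i                                      ≡⟨ stack-reverse i<N j<N k<N ⟩
        stack P i j k                                      ∎
        where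
        open ≡-Reasoning
        j<N : j < N
        j<N = ≤-<-trans j≤k k<N
        i<N : i < N
        i<N = ≤-<-trans i≤j j<N

      cubeOf-stack : ∀ {x y z} → x < N → y < N → z < N → cubeOf x y z ≡ stack P x y z
      cubeOf-stack {x} {y} {z} = sort₃-elim Agree swap rotate sorted x y z
        where
        Agree : ℕ → ℕ → ℕ → Set
        Agree x y z = x < N → y < N → z < N → cubeOf x y z ≡ stack P x y z
        swap : ∀ {x y z} → Agree x y z → Agree y x z
        swap {x} {y} {z} h y<N x<N z<N =
          trans (symmetrize-swap sortedCube x y z) (trans (h x<N y<N z<N) (sym (stack-swap x<N y<N z<N)))
        rotate : ∀ {x y z} → Agree x y z → Agree y z x
        rotate {x} {y} {z} h y<N z<N x<N =
          trans (symmetrize-rotate sortedCube x y z) (trans (h x<N y<N z<N) (sym (stack-rotate x<N y<N z<N)))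
        sorted : ∀ {x y z} → x ≤ y → y ≤ z → Agree x y z
        sorted x≤y y≤z _ _ z<N = trans (symmetrize-sorted sortedCube x≤y y≤z) (sortedCube-stack x≤y y≤z z<N)

      heightsOf-tableOf : ∀ {x y} → x < N → y < N → heightsOf x y ≡ P x y
      heightsOf-tableOf x<N y<N = count-initialSegment N _ (bounded x<N y<N) (cubeOf-stack x<N y<N)

module Bijection (m : ℕ) where

  open Box m

  2n≡N : 2 * n ≡ N
  2n≡N = cong (n +_) (+-identityʳ n)

  <2n : ∀ {x} → x < N → x < 2 * n
  <2n {x} = subst (x <_) (sym 2n≡N)

  <N : ∀ {x} → x < 2 * n → x < N
  <N {x} = subst (x <_) 2n≡N

  toTSSCPP : ABT m → TSSCPP n
  toTSSCPP (A , isA) = tabulate₂ (2 * n) (2 * n) heightsOf ,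
                       tabulate-isTSSCPP {n} (subst (λ L → TSSCPPHeights L heightsOf) (sym 2n≡N) (heightsOf-TSSCPP isS))
    where
    isS : IsSuffixSumTable m (suffixSum A)
    isS = suffixSum-isTable {A = A} isA
    open Cubes (suffixSum A)

  fromTSSCPP : TSSCPP n → ABT m
  fromTSSCPP (π , isπ) = fromSuffixSums (tableOf (val n π)) ,
                         fromSuffixSums-isABT (tableOf-isTable (val-antitoneˡ {n} {π} isπ) (val-antitoneʳ {n} {π} isπ))

  fromTSSCPP∘toTSSCPP : ∀ a → fromTSSCPP (toTSSCPP a) ≡ a
  fromTSSCPP∘toTSSCPP (A , isA) = Σ-T-≡ (trans (fromSuffixSums-cong sameTable) (fromSuffixSums-suffixSum isA))
    where
    isS : IsSuffixSumTable m (suffixSum A)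
    isS = suffixSum-isTable {A = A} isA
    open Cubes (suffixSum A)
    sameTable : ∀ {r c} → r < m → c ≤ suc r → tableOf (val n (tabulate₂ (2 * n) (2 * n) heightsOf)) r c ≡ suffixSum A r c
    sameTable {c = c} r<m _ = tableOf-heightsOf isS (λ x<N y<N → entry-tabulate₂ 0 heightsOf (<2n x<N) (<2n y<N)) {c = c} r<m

  toTSSCPP∘fromTSSCPP : ∀ b → toTSSCPP (fromTSSCPP b) ≡ b
  toTSSCPP∘fromTSSCPP (π , isπ) = Σ-T-≡ (entry-ext 0 _ π λ x<2n y<2n →
    trans (entry-tabulate₂ 0 (Cubes.heightsOf S) x<2n y<2n) (heightsOf-tableOf heights P↓ˡ P↓ʳ sameTable (<N x<2n) (<N y<2n)))
    where
    P : ℕ → ℕ → ℕ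
    P = val n π
    P↓ˡ : ∀ x y → P (suc x) y ≤ P x y
    P↓ˡ = val-antitoneˡ {n} {π} isπ
    P↓ʳ : ∀ x y → P x (suc y) ≤ P x y
    P↓ʳ = val-antitoneʳ {n} {π} isπ
    heights : TSSCPPHeights N P
    heights = subst (λ L → TSSCPPHeights L P) 2n≡N (isTSSCPP-heights {n} {π} isπ)
    S : ℕ → ℕ → ℕ
    S = suffixSum {m} (fromSuffixSums (tableOf P))
    sameTable : ∀ {r c} → r < m → c ≤ suc r → S r c ≡ tableOf P r c
    sameTable = suffixSum-fromSuffixSums {m = m} (tableOf-isTable P↓ˡ P↓ʳ)

theorem1p1 : (n : ℕ) → 1 ≤ n → ABT (n ∸ 1) ⤖ TSSCPP n
theorem1p1 (suc m) _ = ↔⇒⤖ (mk↔ₛ′ toTSSCPP fromTSSCPP toTSSCPP∘fromTSSCPP fromTSSCPP∘toTSSCPP)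
  where open Bijection m
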